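{- Let $G$ be a finite simple graph and $H$ an induced subgraph of $G$ such that for any $h_1,h_2\in V(H)$, $N(h_1)\setminus V(H)=N(h_2)\setminus V(H)$, where $N(h)=\{z:\{h,z\}\in E(G)\}$. If a coloring $k:V(G)\to C$ is a distinguishing coloring of $G$, then the restriction $k\restriction V(H)$ is a distinguishing coloring of $H$.
   Context: A vertex coloring (not necessarily proper) of a graph is distinguishing if the only automorphism of the graph preserving the color of every vertex is the identity. -}

module Defs where

open import Data.Bool using (Bool; false)
open import Data.Nat using (ℕ)
open import Data.Fin using (Fin)
open import Data.Fin.Subset using (Subset; _∈_; _∉_)
open import Data.Product using (Σ; _,_; proj₁)
open import Function.Bundles using (_↔_; Inverse)
open import Relation.Binary.PropositionalEquality using (_≡_)

record SimpleGraph (V : Set) : Set where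
  field
    adj    : V → V → Bool
    sym    : ∀ x y → adj x y ≡ adj y x
    irrefl : ∀ x → adj x x ≡ false
open SimpleGraph public

record Automorphism {V : Set} (G : SimpleGraph V) : Set where
  field
    perm     : V ↔ V
    preserve : ∀ x y → adj G (Inverse.to perm x) (Inverse.to perm y) ≡ adj G x y
open Automorphism public

Distinguishing : {V C : Set} (G : SimpleGraph V) → (V → C) → Set
Distinguishing G k =
  (σ : Automorphism G) →
  (∀ v → k (Inverse.to (perm σ) v) ≡ k v) →
  ∀ v → Inverse.to (perm σ) v ≡ v

VertexIn : {n : ℕ} → Subset n → Set
VertexIn {n} S = Σ (Fin n) (λ v → v ∈ S)

induced : {n : ℕ} → SimpleGraph (Fin n) → (S : Subset n) → SimpleGraph (VertexIn S)
induced G S = record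
  { adj    = λ x y → adj G (proj₁ x) (proj₁ y)
  ; sym    = λ x y → sym G (proj₁ x) (proj₁ y)
  ; irrefl = λ x → irrefl G (proj₁ x)
  }

restrict : {n : ℕ} {C : Set} → (Fin n → C) → (S : Subset n) → VertexIn S → C
restrict k S x = k (proj₁ x)

SameOutsideNbhd : {n : ℕ} → SimpleGraph (Fin n) → Subset n → Set
SameOutsideNbhd G S =
  ∀ h₁ h₂ z → h₁ ∈ S → h₂ ∈ S → z ∉ S → adj G h₁ z ≡ adj G h₂ z

{-# OPTIONS --safe #-}
module Submission where

open import Defs
open import Data.Nat using (ℕ)
open import Data.Fin using (Fin)
open import Data.Fin.Subset using (Subset; _∈_; _∉_)
open import Data.Fin.Subset.Properties using (_∈?_)
open import Data.Vec.Properties.WithK using ([]=-irrelevant)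
open import Data.Product using (_,_; proj₁; proj₂)
open import Function.Bundles using (_↔_; Inverse; mk↔ₛ′)
open import Relation.Binary.PropositionalEquality
  using (_≡_; refl; cong; trans; module ≡-Reasoning)
open import Relation.Nullary using (yes; no; contradiction)

-- An automorphism of G[S] that preserves colours extends, by the identity
-- outside S, to a colour-preserving automorphism of G: an edge between a
-- vertex of S and a vertex z outside S is preserved because every vertex of
-- S is adjacent to z or none is. As k is distinguishing, the extension is the
-- identity, hence so is the automorphism of G[S].

module _ {n : ℕ} {S : Subset n} where

  VertexIn-≡ : {x y : VertexIn S} → proj₁ x ≡ proj₁ y → x ≡ y
  VertexIn-≡ {v , p} {.v , q} refl = cong (v ,_) ([]=-irrelevant p q)

  extend : (VertexIn S → VertexIn S) → Fin n → Fin n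
  extend f v with v ∈? S
  ... | yes v∈S = proj₁ (f (v , v∈S))
  ... | no _    = v

  extend-∈ : ∀ f {v} (v∈S : v ∈ S) → extend f v ≡ proj₁ (f (v , v∈S))
  extend-∈ f {v} v∈S with v ∈? S
  ... | yes v∈S′ = cong (λ p → proj₁ (f (v , p))) ([]=-irrelevant v∈S′ v∈S)
  ... | no v∉S   = contradiction v∈S v∉S

  extend-∉ : ∀ f {v} → v ∉ S → extend f v ≡ v
  extend-∉ f {v} v∉S with v ∈? S
  ... | yes v∈S = contradiction v∈S v∉S
  ... | no _    = refl

  extend-inverse : ∀ f g → (∀ x → g (f x) ≡ x) → ∀ v → extend g (extend f v) ≡ v
  extend-inverse f g g∘f≡id v with v ∈? S
  ... | yes v∈S = trans (extend-∈ g (proj₂ (f (v , v∈S)))) (cong proj₁ (g∘f≡id (v , v∈S)))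
  ... | no v∉S  = extend-∉ g v∉S

  extend-↔ : VertexIn S ↔ VertexIn S → Fin n ↔ Fin n
  extend-↔ π = mk↔ₛ′ (extend to) (extend from)
    (extend-inverse from to strictlyInverseˡ)
    (extend-inverse to from strictlyInverseʳ)
    where open Inverse π

  module _ {G : SimpleGraph (Fin n)} (same : SameOutsideNbhd G S) where

    extend-preserves-adj : (σ : Automorphism (induced G S)) →
      let f = Inverse.to (perm σ) in
      ∀ x y → adj G (extend f x) (extend f y) ≡ adj G x y
    extend-preserves-adj σ x y with x ∈? S | y ∈? S
    ... | yes x∈S | yes y∈S = preserve σ (x , x∈S) (y , y∈S)
    ... | yes x∈S | no y∉S  = same _ x y (proj₂ (Inverse.to (perm σ) (x , x∈S))) x∈S y∉S
    ... | no x∉S  | yes y∈S = begin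
      adj G x fy  ≡⟨ SimpleGraph.sym G x fy ⟩
      adj G fy x  ≡⟨ same fy y x (proj₂ (Inverse.to (perm σ) (y , y∈S))) y∈S x∉S ⟩
      adj G y x   ≡⟨ SimpleGraph.sym G y x ⟩
      adj G x y   ∎
      where
      open ≡-Reasoning
      fy = proj₁ (Inverse.to (perm σ) (y , y∈S))
    ... | no _    | no _    = refl

    extendAutomorphism : Automorphism (induced G S) → Automorphism G
    extendAutomorphism σ = record
      { perm     = extend-↔ (perm σ)
      ; preserve = extend-preserves-adj σ
      }

  extend-preserves-colour : {C : Set} (k : Fin n → C) (f : VertexIn S → VertexIn S) →
    (∀ x → restrict k S (f x) ≡ restrict k S x) → ∀ v → k (extend f v) ≡ k v
  extend-preserves-colour k f f-preserves v with v ∈? S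
  ... | yes v∈S = f-preserves (v , v∈S)
  ... | no _    = refl

lemma2 : (n : ℕ) (G : SimpleGraph (Fin n)) (S : Subset n) (C : Set) (k : Fin n → C) →
    SameOutsideNbhd G S →
    Distinguishing G k →
    Distinguishing (induced G S) (restrict k S)
lemma2 n G S C k same distinguishing σ σ-preserves (v , v∈S) = VertexIn-≡ (begin
  proj₁ (f (v , v∈S))  ≡⟨ extend-∈ f v∈S ⟨
  extend f v           ≡⟨ distinguishing (extendAutomorphism same σ)
                            (extend-preserves-colour k f σ-preserves) v ⟩
  v                    ∎)
  where
  open ≡-Reasoning
  f = Inverse.to (perm σ)
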